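{- Let $n,d\ge1$, fix a fine mixed subdivision of $n\Delta_{d-1}$, and let $\mathcal{M}$ be the set of all $(n,d)$-types $(J_1,\dots,J_n)$ such that some cell $\Delta_{I_1}+\dots+\Delta_{I_n}$ of the subdivision satisfies $\emptyset\ne J_i\subseteq I_i$ for all $i$. If for any two types $A,B\in\mathcal{M}$ there is a strong path in $\mathcal{M}$ between $A$ and $B$, then $\mathcal{M}$ satisfies the elimination property: for all $A,B\in\mathcal{M}$ and every $j\in[n]$ there exists $C\in\mathcal{M}$ with $C_j=A_j\cup B_j$ and $C_k\in\{A_k,B_k,A_k\cup B_k\}$ for all $k\in[n]$.
   Context: $\Delta_{d-1}=\mathrm{conv}(e_1,\dots,e_d)\subset\mathbb{R}^d$, $\Delta_I=\mathrm{conv}(e_j:j\in I)$, and $n\Delta_{d-1}$ is the Minkowski sum of $n$ copies of $\Delta_{d-1}$. In a fine mixed subdivision of $n\Delta_{d-1}$ (a decomposition into $(d-1)$-dimensional Minkowski cells meeting in common faces, admitting no refinement) each cell is $\Delta_{I_1}+\dots+\Delta_{I_n}$ with $\sum(|I_i|-1)=d-1$, and $(I_1,\dots,I_n)$ is a spanning tree of $K_{n,d}$ (edges $(i,j)$, $j\in I_i$); a type $(J_1,\dots,J_n)$ with $\emptyset\ne J_i\subseteq I_i$ encodes a face of the cell. An $(n,d)$-type is an $n$-tuple of nonempty subsets of $[d]$. Two types are adjacent if they differ in exactly one coordinate and in that coordinate the two sets differ by exactly one element (one is obtained from the other by adding one element). A path between $A$ and $B$ is a sequence $A=C^0,C^1,\dots,C^q=B$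 with $C^{t}$ adjacent to $C^{t+1}$ for all $t$. Coordinate $i$ is strong for the path if: (1) once some element has been deleted from the $i$-th coordinate, no element is afterwards added to it; (2) $C^t_i\subseteq A_i\cup B_i$ for all $t$; (3) any element added to the $i$-th coordinate is not deleted later. A strong path is a path that is strong in every coordinate. -}

module Defs where

open import Data.Nat as ℕ using (ℕ; zero; suc; _∸_; _<_)
open import Data.Fin using (Fin; zero; suc; toℕ; inject₁; fromℕ)
open import Data.Fin.Subset using (Subset; _∈_; _∉_; _⊆_; _∪_; ∣_∣; Nonempty; ⊤)
open import Data.Rational as ℚ using (ℚ; 0ℚ; 1ℚ)
open import Data.Integer using (+_)
open import Data.Product using (Σ; ∃; ∃-syntax; _×_)
open import Data.Sum using (_⊎_)
open import Relation.Binary.PropositionalEquality using (_≡_; _≢_)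
open import Relation.Nullary using (¬_)

sumℕ : {m : ℕ} → (Fin m → ℕ) → ℕ
sumℕ {zero}  f = 0
sumℕ {suc m} f = f zero ℕ.+ sumℕ (λ i → f (suc i))

sumℚ : {m : ℕ} → (Fin m → ℚ) → ℚ
sumℚ {zero}  f = 0ℚ
sumℚ {suc m} f = f zero ℚ.+ sumℚ (λ i → f (suc i))

PreType : ℕ → ℕ → Set
PreType n d = Fin n → Subset d

IsType : {n d : ℕ} → PreType n d → Set
IsType {n} A = (i : Fin n) → Nonempty (A i)

_≤ᵗ_ : {n d : ℕ} → PreType n d → PreType n d → Set
J ≤ᵗ I = ∀ i → J i ⊆ I i

Point : ℕ → Set
Point d = Fin d → ℚ

-- x ∈ Δ_{I_1} + … + Δ_{I_n}:
-- x = Σ_i y_i with y_i = Σ_{j ∈ I_i} λ_{ij} e_j, λ_{ij} ≥ 0, Σ_j λ_{ij} = 1.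
InCell : {n d : ℕ} → PreType n d → Point d → Set
InCell {n} {d} I x =
  Σ (Fin n → Fin d → ℚ) λ lam →
      (∀ i j → 0ℚ ℚ.≤ lam i j)
    × (∀ i j → j ∉ I i → lam i j ≡ 0ℚ)
    × (∀ i → sumℚ (lam i) ≡ 1ℚ)
    × (∀ j → x j ≡ sumℚ (λ i → lam i j))

InDilatedSimplex : (n d : ℕ) → Point d → Set
InDilatedSimplex n d x = (∀ j → 0ℚ ℚ.≤ x j) × sumℚ x ≡ (+ n) ℚ./ 1

-- Spanning trees of K_{n,d}; edges (i,j) with j ∈ I_i

EdgeClosed : {n d : ℕ} → PreType n d → Subset n → Subset d → Set
EdgeClosed {n} {d} I L R =
    (∀ i j → i ∈ L → j ∈ I i → j ∈ R)
  × (∀ i j → j ∈ R → j ∈ I i → i ∈ L)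

Connected : {n d : ℕ} → PreType n d → Set
Connected I = ∀ L R → EdgeClosed I L R → (Nonempty L ⊎ Nonempty R) → (L ≡ ⊤ × R ≡ ⊤)

IsSpanningTree : {n d : ℕ} → PreType n d → Set
IsSpanningTree {n} {d} I = Connected I × sumℕ (λ i → ∣ I i ∣) ≡ n ℕ.+ d ∸ 1

FineCell : {n d : ℕ} → PreType n d → Set
FineCell {n} {d} I =
  IsType I × sumℕ (λ i → ∣ I i ∣ ∸ 1) ≡ d ∸ 1 × IsSpanningTree I

record FineMixedSubdivision (n d : ℕ) : Set where
  field
    numCells : ℕ
    cell     : Fin numCells → PreType n d
    fine     : ∀ c → FineCell (cell c)
    covers   : ∀ x → InDilatedSimplex n d x → ∃[ c ] InCell (cell c) x
    meet     : ∀ c c' →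
                 (∀ x → ¬ (InCell (cell c) x × InCell (cell c') x))
               ⊎ (∃[ J ] (IsType J × J ≤ᵗ cell c × J ≤ᵗ cell c'
                   × (∀ x → (InCell (cell c) x × InCell (cell c') x) → InCell J x)
                   × (∀ x → InCell J x → InCell (cell c) x × InCell (cell c') x)))

InM : {n d : ℕ} → FineMixedSubdivision n d → PreType n d → Set
InM S J = IsType J × ∃[ c ] (J ≤ᵗ FineMixedSubdivision.cell S c)

AddsAt : {n d : ℕ} → PreType n d → PreType n d → Fin n → Fin d → Set
AddsAt A B i x = (∀ k → k ≢ i → A k ≡ B k) × x ∉ A i × B i ≡ A i ∪ Data.Fin.Subset.⁅ x ⁆

Adjacent : {n d : ℕ} → PreType n d → PreType n d → Set
Adjacent A B = ∃[ i ] ∃[ x ] (AddsAt A B i x ⊎ AddsAt B A i x)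

record Path {n d : ℕ} (A B : PreType n d) : Set where
  field
    len   : ℕ
    C     : Fin (suc len) → PreType n d
    start : C zero ≡ A
    end   : C (fromℕ len) ≡ B
    adj   : ∀ (t : Fin len) → Adjacent (C (inject₁ t)) (C (suc t))

module _ {n d : ℕ} {A B : PreType n d} (P : Path A B) where
  open Path P

  AddedAt : Fin len → Fin n → Fin d → Set
  AddedAt t i x = x ∉ C (inject₁ t) i × x ∈ C (suc t) i

  DeletedAt : Fin len → Fin n → Fin d → Set
  DeletedAt t i x = x ∈ C (inject₁ t) i × x ∉ C (suc t) i

  StrongAt : Fin n → Set
  StrongAt i =
      (∀ t t' x x' → toℕ t < toℕ t' → DeletedAt t i x → ¬ AddedAt t' i x')
    × (∀ t → C t i ⊆ A i ∪ B i)
    × (∀ t t' x → toℕ t < toℕ t' → AddedAt t i x → ¬ DeletedAt t' i x)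

  IsStrong : Set
  IsStrong = ∀ i → StrongAt i

  PathIn : (PreType n d → Set) → Set
  PathIn M = ∀ t → M (C t)

StrongPathIn : {n d : ℕ} → (PreType n d → Set) → PreType n d → PreType n d → Set
StrongPathIn M A B = Σ (Path A B) λ P → IsStrong P × PathIn P M

Elimination : {n d : ℕ} → (PreType n d → Set) → Set
Elimination {n} M =
  ∀ A B → M A → M B → ∀ (j : Fin n) →
    ∃[ C ] (M C × C j ≡ A j ∪ B j
           × (∀ k → C k ≡ A k ⊎ C k ≡ B k ⊎ C k ≡ A k ∪ B k))

module Submission where

-- Fix a strong path C⁰ = A, …, Cᵍ = B inside 𝓜 and a coordinate k.
-- Consecutive types differ by a single element, so every step either does
-- not shrink the k-th coordinate or is a pure deletion from it; by strong
-- condition (1) no element is added after the first deletion.  Hence the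
-- sequence C⁰ₖ, …, Cᵍₖ is unimodal: it grows up to a peak and shrinks
-- afterwards, so every Cᵗₖ contains Aₖ (before the peak) or Bₖ (after
-- it), and the peak itself contains Aₖ ∪ Bₖ.  Taking D = Cᵗ at the peak of
-- the prescribed coordinate j, the type with coordinates Aⱼ ∪ Bⱼ at j and,
-- elsewhere, whichever of Aₖ, Bₖ lies in Dₖ, is a face type of the cell
-- containing D, hence lies in 𝓜 and witnesses the elimination property.

open import Defs
open import Data.Nat using (ℕ; zero; suc; _≤_; _<_; z≤n; s≤s; _≤?_)
open import Data.Nat.Properties using (≤-trans; <⇒≤; <⇒≱; m≤n⇒m<n∨m≡n; <-≤-trans; ≰⇒>)
open import Data.Fin using (Fin; zero; suc; toℕ; inject₁; fromℕ; _≟_)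
open import Data.Fin.Properties using (toℕ-injective; toℕ-inject₁; toℕ-fromℕ; toℕ<n)
open import Data.Fin.Subset using (Subset; _∈_; _∉_; _⊆_; _∪_; Nonempty)
open import Data.Fin.Subset.Properties using (_∈?_; ⊆-refl; ⊆-trans; x∈⁅x⁆; p⊆p∪q; q⊆p∪q; x∈p∪q⁻)
open import Data.Product using (Σ; ∃-syntax; _×_; _,_; proj₁; proj₂)
open import Data.Sum using (_⊎_; inj₁; inj₂)
open import Data.Empty using (⊥-elim)
open import Function using (_∘_)
open import Relation.Binary.PropositionalEquality using (_≡_; refl; sym; subst)
open import Relation.Nullary using (yes; no)

∪-least : ∀ {d} {p q r : Subset d} → p ⊆ r → q ⊆ r → p ∪ q ⊆ r
∪-least {p = p} {q} p⊆r q⊆r x∈p∪q with x∈p∪q⁻ p q x∈p∪q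
... | inj₁ x∈p = p⊆r x∈p
... | inj₂ x∈q = q⊆r x∈q

all-or-first : ∀ {m} {P Q : Fin m → Set} → (∀ s → P s ⊎ Q s) →
               (∀ s → P s) ⊎ (∃[ s ] (Q s × (∀ s' → toℕ s' < toℕ s → P s')))
all-or-first {zero} _ = inj₁ λ ()
all-or-first {suc m} {P} {Q} P⊎Q with P⊎Q zero
... | inj₂ q = inj₂ (zero , q , λ _ ())
... | inj₁ p with all-or-first {m} {P ∘ suc} {Q ∘ suc} (P⊎Q ∘ suc)
...   | inj₁ all = inj₁ λ { zero → p ; (suc s) → all s }
...   | inj₂ (s , q , before) =
          inj₂ (suc s , q , λ { zero _ → p ; (suc s') (s≤s lt) → before s' lt })

module Unimodal {A : Set} (_≼_ : A → A → Set)
                (≼-refl : ∀ {x} → x ≼ x)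
                (≼-trans : ∀ {x y z} → x ≼ y → y ≼ z → x ≼ z) where

  Rises Falls : ∀ {m} → (Fin (suc m) → A) → Fin m → Set
  Rises c s = c (inject₁ s) ≼ c (suc s)
  Falls c s = c (suc s) ≼ c (inject₁ s)

  start≼ : ∀ {m} (c : Fin (suc m) → A) (t : Fin (suc m)) →
           (∀ s → toℕ s < toℕ t → Rises c s) → c zero ≼ c t
  start≼ c zero _ = ≼-refl
  start≼ {suc m} c (suc t) rises =
    ≼-trans (rises zero (s≤s z≤n)) (start≼ (c ∘ suc) t λ s lt → rises (suc s) (s≤s lt))

  end≼ : ∀ {m} (c : Fin (suc m) → A) (t : Fin (suc m)) →
         (∀ s → toℕ t ≤ toℕ s → Falls c s) → c (fromℕ m) ≼ c t
  end≼ {zero} c zero _ = ≼-refl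
  end≼ {suc m} c zero falls =
    ≼-trans (end≼ (c ∘ suc) zero λ s _ → falls (suc s) z≤n) (falls zero z≤n)
  end≼ {suc m} c (suc t) falls = end≼ (c ∘ suc) t λ s le → falls (suc s) (s≤s le)

  record Peak {m} (c : Fin (suc m) → A) : Set where
    field
      peak    : Fin (suc m)
      rising  : ∀ s → toℕ s < toℕ peak → Rises c s
      falling : ∀ s → toℕ peak ≤ toℕ s → Falls c s

    start-or-end≼ : ∀ t → c zero ≼ c t ⊎ c (fromℕ m) ≼ c t
    start-or-end≼ t with toℕ t ≤? toℕ peak
    ... | yes t≤p = inj₁ (start≼ c t λ s lt → rising s (<-≤-trans lt t≤p))
    ... | no  t≰p = inj₂ (end≼ c t λ s le → falling s (≤-trans (<⇒≤ (≰⇒> t≰p)) le))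

    start≼peak : c zero ≼ c peak
    start≼peak = start≼ c peak rising

    end≼peak : c (fromℕ m) ≼ c peak
    end≼peak = end≼ c peak falling

  -- A sequence each of whose steps rises or is a "turn" that falls, and which
  -- falls at every step after a turn, has a peak: the first turn, if any.
  peak-of : ∀ {m} (c : Fin (suc m) → A) (Turn : Fin m → Set) →
            (∀ s → Rises c s ⊎ (Turn s × Falls c s)) →
            (∀ s₀ s → toℕ s₀ < toℕ s → Turn s₀ → Falls c s) → Peak c
  peak-of {m} c Turn step falls-after with all-or-first step
  ... | inj₁ all-rise = record
    { peak    = fromℕ m
    ; rising  = λ s _ → all-rise s
    ; falling = λ s le → ⊥-elim (<⇒≱ (toℕ<n s) (subst (_≤ toℕ s) (toℕ-fromℕ m) le))
    }
  ... | inj₂ (s₀ , (turn , falls₀) , before) = record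
    { peak    = inject₁ s₀
    ; rising  = λ s lt → before s (subst (toℕ s <_) (toℕ-inject₁ s₀) lt)
    ; falling = falling
    }
    where
    falling : ∀ s → toℕ (inject₁ s₀) ≤ toℕ s → Falls c s
    falling s le with m≤n⇒m<n∨m≡n (subst (_≤ toℕ s) (toℕ-inject₁ s₀) le)
    ... | inj₁ lt = falls-after s₀ s lt turn
    ... | inj₂ eq with toℕ-injective eq
    ...   | refl = falls₀

step-shape : ∀ {n d} {X Y : PreType n d} → Adjacent X Y → ∀ k →
             X k ⊆ Y k ⊎ ((∃[ x ] (x ∈ X k × x ∉ Y k)) × Y k ⊆ X k)
step-shape (i , x , inj₁ (same , _ , Yi≡Xi∪x)) k with k ≟ i
... | yes refl = inj₁ λ y∈ → subst (_ ∈_) (sym Yi≡Xi∪x) (p⊆p∪q _ y∈)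
... | no  k≢i  = inj₁ λ y∈ → subst (_ ∈_) (same k k≢i) y∈
step-shape (i , x , inj₂ (same , x∉Yi , Xi≡Yi∪x)) k with k ≟ i
... | yes refl = inj₂ ( (x , subst (x ∈_) (sym Xi≡Yi∪x) (q⊆p∪q _ _ (x∈⁅x⁆ x)) , x∉Yi)
                      , λ y∈ → subst (_ ∈_) (sym Xi≡Yi∪x) (p⊆p∪q _ y∈) )
... | no  k≢i  = inj₁ λ y∈ → subst (_ ∈_) (sym (same k k≢i)) y∈

module StrongPath {n d : ℕ} {A B : PreType n d} (P : Path A B) (strong : IsStrong P) where
  open Path P
  open Unimodal {A = Subset d} _⊆_ ⊆-refl ⊆-trans

  falls-after-deletion : ∀ k s₀ s → toℕ s₀ < toℕ s →
                         ∃[ x ] DeletedAt P s₀ k x → Falls (λ t → C t k) s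
  falls-after-deletion k s₀ s lt (x , deleted) {y} y∈ with y ∈? C (inject₁ s) k
  ... | yes y∈before = y∈before
  ... | no  y∉before = ⊥-elim (proj₁ (strong k) s₀ s x y lt deleted (y∉before , y∈))

  coordinate-peak : ∀ k → Peak (λ t → C t k)
  coordinate-peak k = peak-of (λ t → C t k) (λ s → ∃[ x ] DeletedAt P s k x)
                              (λ s → step-shape (adj s) k) (falls-after-deletion k)

  A⊆start : ∀ k → A k ⊆ C zero k
  A⊆start k = subst (λ X → _ ∈ X k) (sym start)

  B⊆end : ∀ k → B k ⊆ C (fromℕ len) k
  B⊆end k = subst (λ X → _ ∈ X k) (sym end)

  contains-A-or-B : ∀ t k → A k ⊆ C t k ⊎ B k ⊆ C t k
  contains-A-or-B t k with Peak.start-or-end≼ (coordinate-peak k) t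
  ... | inj₁ start⊆ = inj₁ (start⊆ ∘ A⊆start k)
  ... | inj₂ end⊆   = inj₂ (end⊆ ∘ B⊆end k)

  dominating-type : ∀ j → ∃[ t ] (A j ∪ B j ⊆ C t j × (∀ k → A k ⊆ C t k ⊎ B k ⊆ C t k))
  dominating-type j = peak , ∪-least (start≼peak ∘ A⊆start j) (end≼peak ∘ B⊆end j)
                           , contains-A-or-B peak
    where open Peak (coordinate-peak j)

InM-downward : ∀ {n d} (S : FineMixedSubdivision n d) {J D : PreType n d} →
               InM S D → IsType J → J ≤ᵗ D → InM S J
InM-downward S (_ , c , D≤cell) J-type J≤D = J-type , c , λ k → D≤cell k ∘ J≤D k

module Merge {n d : ℕ} (S : FineMixedSubdivision n d) {A B D : PreType n d}
             (A∈M : InM S A) (B∈M : InM S B) (D∈M : InM S D) (j : Fin n)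
             (A∪B⊆D : A j ∪ B j ⊆ D j) (side : ∀ k → A k ⊆ D k ⊎ B k ⊆ D k) where

  record Admissible (k : Fin n) (X : Subset d) : Set where
    constructor admissible
    field
      inside   : X ⊆ D k
      nonempty : Nonempty X
      among    : X ≡ A k ⊎ X ≡ B k ⊎ X ≡ A k ∪ B k

  choose : ∀ k → Σ (Subset d) (Admissible k)
  choose k with k ≟ j | side k
  ... | yes refl | _ = A k ∪ B k , admissible A∪B⊆D nonempty-∪ (inj₂ (inj₂ refl))
    where
    nonempty-∪ : Nonempty (A k ∪ B k)
    nonempty-∪ with proj₁ A∈M k
    ... | x , x∈A = x , p⊆p∪q (B k) x∈A
  ... | no _ | inj₁ A⊆D = A k , admissible A⊆D (proj₁ A∈M k) (inj₁ refl)
  ... | no _ | inj₂ B⊆D = B k , admissible B⊆D (proj₁ B∈M k) (inj₂ (inj₁ refl))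

  merged : PreType n d
  merged k = proj₁ (choose k)

  merged-at-j : merged j ≡ A j ∪ B j
  merged-at-j with j ≟ j | side j
  ... | yes refl | _ = refl
  ... | no  j≢j  | _ = ⊥-elim (j≢j refl)

  eliminates : ∃[ C ] (InM S C × C j ≡ A j ∪ B j
                       × (∀ k → C k ≡ A k ⊎ C k ≡ B k ⊎ C k ≡ A k ∪ B k))
  eliminates = merged
             , InM-downward S D∈M (nonempty ∘ admissibility) (inside ∘ admissibility)
             , merged-at-j
             , among ∘ admissibility
    where
    open Admissible
    admissibility : ∀ k → Admissible k (merged k)
    admissibility k = proj₂ (choose k)

lemma4p3 : (n d : ℕ) → 1 ≤ n → 1 ≤ d → (S : FineMixedSubdivision n d) → (∀ A B → InM S A → InM S B → StrongPathIn (InM S) A B) → Elimination (InM S)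
lemma4p3 n d _ _ S strong-paths A B A∈M B∈M j =
  let (P , P-strong , P-in-M) = strong-paths A B A∈M B∈M
      (t , A∪B⊆Cₜ , side) = StrongPath.dominating-type P P-strong j
  in Merge.eliminates S A∈M B∈M (P-in-M t) j A∪B⊆Cₜ side
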